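{- Let $n\geq0$, $\mathbf{k}$ a commutative ring, $\mathcal{A}=\mathbf{k}[S_n]$, and $k\in\mathbb{N}$. Then $\mathcal{I}_k\mathcal{J}_k=\mathcal{J}_k\mathcal{I}_k=0$.
   Context: $[n]=\{1,\dots,n\}$. A set composition of $[n]$ is a tuple $(A_1,\dots,A_m)$ of pairwise disjoint nonempty subsets with union $[n]$ (length $m$). For set compositions $\mathbf{A},\mathbf{B}$ of equal length, $\nabla_{\mathbf{B},\mathbf{A}}:=\sum_{w\in S_n,\ w(A_i)=B_i\ \forall i}w$. For $U\subseteq[n]$, $\nabla_U^-:=\sum_{w\in S_n,\ w(i)=i\ \forall i\notin U}(-1)^w w$. $\mathcal{I}_k:=\operatorname{span}_{\mathbf{k}}\{\nabla_{\mathbf{B},\mathbf{A}}\mid\text{set compositions with }\ell(\mathbf{A})=\ell(\mathbf{B})\leq k\}$ and $\mathcal{J}_k:=\mathcal{A}\cdot\operatorname{span}_{\mathbf{k}}\{\nabla_U^-\mid U\subseteq[n],\ |U|=k+1\}\cdot\mathcal{A}$. -}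

module Defs where

open import Level using (_⊔_)
open import Algebra.Bundles using (CommutativeRing)
open import Data.Nat as ℕ using (ℕ; zero; suc)
open import Data.Fin as Fin using (Fin)
open import Data.Fin.Properties using (all?; any?)
open import Data.Fin.Subset using (Subset; _∈_; _∉_; _∩_; Nonempty; Empty; ∣_∣)
open import Data.Fin.Subset.Properties using (_∈?_)
open import Data.Vec as Vec using (Vec; []; _∷_; lookup; tabulate)
open import Data.Vec.Properties using (≡-dec)
open import Data.List as List using (List; [_]; concatMap; map; foldr; mapMaybe; allFin; filter; length)
open import Data.Maybe using (Maybe; just; nothing)
open import Data.Product using (Σ; Σ-syntax; ∃; ∃-syntax; _×_; _,_; proj₁; proj₂)
open import Data.Bool using (if_then_else_)
open import Relation.Nullary using (Dec; yes; no; ¬_; ⌊_⌋)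
open import Relation.Nullary.Decidable using (_×-dec_; _→-dec_; ¬?)
open import Relation.Binary.PropositionalEquality using (_≡_; _≢_)

-- A permutation of [n] (encoded as Fin n) is given by its one-line
-- notation: a vector v of length n whose lookup function is injective
-- (hence bijective).

IsPerm : ∀ {n} → Vec (Fin n) n → Set
IsPerm {n} v = ∀ (i j : Fin n) → lookup v i ≡ lookup v j → i ≡ j

isPerm? : ∀ {n} (v : Vec (Fin n) n) → Dec (IsPerm v)
isPerm? v = all? (λ i → all? (λ j → (lookup v i Fin.≟ lookup v j) →-dec (i Fin.≟ j)))

Perm : ℕ → Set
Perm n = Σ (Vec (Fin n) n) IsPerm

app : ∀ {n} → Perm n → Fin n → Fin n
app w i = lookup (proj₁ w) i

compose : ∀ {n} → Perm n → Perm n → Vec (Fin n) n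
compose u v = tabulate (λ i → app u (app v i))

allVecs : (n m : ℕ) → List (Vec (Fin n) m)
allVecs n zero    = [ [] ]
allVecs n (suc m) = concatMap (λ i → map (i ∷_) (allVecs n m)) (allFin n)

toPerm : ∀ {n} → Vec (Fin n) n → Maybe (Perm n)
toPerm v with isPerm? v
... | yes p = just (v , p)
... | no _  = nothing

allPerms : (n : ℕ) → List (Perm n)
allPerms n = mapMaybe toPerm (allVecs n n)

inversions : ∀ {n} → Perm n → ℕ
inversions {n} w =
  length (filter (λ p → (proj₁ p Fin.<? proj₂ p) ×-dec (app w (proj₂ p) Fin.<? app w (proj₁ p)))
                 (concatMap (λ i → map (i ,_) (allFin n)) (allFin n)))

record SetComp (n m : ℕ) : Set where
  field
    block    : Fin m → Subset n
    nonempty : ∀ i → Nonempty (block i)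
    disjoint : ∀ i j → i ≢ j → Empty (block i ∩ block j)
    covers   : ∀ (x : Fin n) → ∃[ i ] (x ∈ block i)
open SetComp public

MapsComp : ∀ {n m} → Perm n → SetComp n m → SetComp n m → Set
MapsComp {n} {m} w 𝐀 𝐁 =
  ∀ (i : Fin m) (y : Fin n) →
    (y ∈ block 𝐁 i → ∃[ x ] (x ∈ block 𝐀 i × app w x ≡ y)) ×
    (∃[ x ] (x ∈ block 𝐀 i × app w x ≡ y) → y ∈ block 𝐁 i)

mapsComp? : ∀ {n m} (w : Perm n) (𝐀 𝐁 : SetComp n m) → Dec (MapsComp w 𝐀 𝐁)
mapsComp? w 𝐀 𝐁 = all? λ i → all? λ y →
  let ex = any? (λ x → (x ∈? block 𝐀 i) ×-dec (app w x Fin.≟ y)) in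
  ((y ∈? block 𝐁 i) →-dec ex) ×-dec (ex →-dec (y ∈? block 𝐁 i))

FixesOutside : ∀ {n} → Subset n → Perm n → Set
FixesOutside U w = ∀ i → i ∉ U → app w i ≡ i

fixesOutside? : ∀ {n} (U : Subset n) (w : Perm n) → Dec (FixesOutside U w)
fixesOutside? U w = all? λ i → ¬? (i ∈? U) →-dec (app w i Fin.≟ i)

-- The group algebra 𝒜 = k[S_n] over a commutative ring k.
-- An element is its coefficient function S_n → k (S_n is finite, so this
-- is the free k-module on S_n).

module GroupAlgebra {c ℓ} (R : CommutativeRing c ℓ) where
  open CommutativeRing R

  El : ℕ → Set c
  El n = Perm n → Carrier

  sumS : ∀ {n} → (Perm n → Carrier) → Carrier
  sumS {n} f = foldr _+_ 0# (map f (allPerms n))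

  _≋_ : ∀ {n} → El n → El n → Set ℓ
  x ≋ y = ∀ w → x w ≈ y w

  zeroA : ∀ {n} → El n
  zeroA _ = 0#

  _·_ : ∀ {n} → El n → El n → El n
  (a · b) w = sumS (λ u → sumS (λ v →
                if ⌊ ≡-dec Fin._≟_ (compose u v) (proj₁ w) ⌋ then a u * b v else 0#))

  negOnePow : ℕ → Carrier
  negOnePow zero    = 1#
  negOnePow (suc m) = - negOnePow m

  sign : ∀ {n} → Perm n → Carrier
  sign w = negOnePow (inversions w)

  ∇ : ∀ {n m} → SetComp n m → SetComp n m → El n
  ∇ 𝐁 𝐀 w = if ⌊ mapsComp? w 𝐀 𝐁 ⌋ then 1# else 0#

  ∇⁻ : ∀ {n} → Subset n → El n
  ∇⁻ U w = if ⌊ fixesOutside? U w ⌋ then sign w else 0#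

  sumEl : ∀ {n} → List (El n) → El n
  sumEl xs w = foldr _+_ 0# (map (λ x → x w) xs)

  record IGen (n k : ℕ) : Set c where
    field
      len  : ℕ
      len≤ : len ℕ.≤ k
      coef : Carrier
      𝐀 𝐁  : SetComp n len

  IGen-el : ∀ {n k} → IGen n k → El n
  IGen-el g = λ w → IGen.coef g * ∇ (IGen.𝐁 g) (IGen.𝐀 g) w

  Inℐ : (n k : ℕ) → El n → Set (c ⊔ ℓ)
  Inℐ n k x = ∃[ gs ] (x ≋ sumEl (map (IGen-el {n} {k}) gs))

  record JGen (n k : ℕ) : Set c where
    field
      left  : El n
      U     : Subset n
      |U|   : ∣ U ∣ ≡ suc k
      right : El n

  JGen-el : ∀ {n k} → JGen n k → El n
  JGen-el g = (JGen.left g · ∇⁻ (JGen.U g)) · JGen.right g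

  In𝒥 : (n k : ℕ) → El n → Set (c ⊔ ℓ)
  In𝒥 n k x = ∃[ gs ] (x ≋ sumEl (map (JGen-el {n} {k}) gs))

-- Both products are spanned by terms containing ∇_{B,A} y ∇⁻_U or ∇⁻_U z ∇_{B,A} for single
-- permutations y, z and |U| = k + 1 > ℓ(A), so it suffices that these vanish. For the first, the
-- pigeonhole principle gives p ≠ q in U with y p, y q in one block of A; then s = (y p  y q)
-- satisfies ∇_{B,A} s = ∇_{B,A}, s y = y (p q) and (p q) ∇⁻_U = -∇⁻_U. So the substitution
-- (a , d) ↦ (a s , (p q) d) negates every term of the coefficient sum of ∇_{B,A} y ∇⁻_U, and
-- splitting that sum according to a (y p) < a (y q) cancels the terms in pairs, without dividing
-- by 2. The second product is symmetric, using z⁻¹. The sign of ∇⁻_U flips under a transposition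
-- because swapping two adjacent values changes the number of inversions by one, and every
-- transposition is a conjugate of an adjacent one by transpositions.

module Submission where

open import Defs
open import Algebra.Bundles using (CommutativeRing)
open import Data.Nat using (ℕ)
open import Data.Product using (_×_)

open import Level using (Level)
open import Data.Bool using (Bool; true; false; not; if_then_else_)
open import Data.Bool.Properties using (not-involutive)
open import Data.Empty using (⊥-elim)
import Data.Nat as ℕ
import Data.Nat.Properties as ℕₚ
open import Data.Fin as Fin using (Fin; toℕ; _<_; _<?_; _≟_)
import Data.Fin.Properties as Finₚ
open import Data.Fin.Permutation.Components using (transpose)
open import Data.Fin.Subset using (Subset; _∈_; _∉_; ∣_∣)
import Data.Fin.Subset.Properties as Subsetₚ
open import Data.List
  using (List; []; _∷_; map; foldr; concatMap; allFin; mapMaybe; filter; length; _++_; cartesianProductWith)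
import Data.List.Properties as Listₚ
open import Data.List.Membership.Propositional using () renaming (_∈_ to _∈ₗ_)
import Data.List.Membership.Propositional.Properties as Membershipₚ
open import Data.List.Relation.Unary.All as All using (All; []; _∷_)
open import Data.List.Relation.Unary.AllPairs using ([]; _∷_)
open import Data.List.Relation.Unary.Any using (here; there)
open import Data.List.Relation.Unary.Unique.Propositional using (Unique)
import Data.List.Relation.Unary.Unique.Propositional.Properties as Uniqueₚ
open import Data.Vec as Vec using (Vec; []; _∷_; lookup; tabulate)
import Data.Vec.Properties as Vecₚ
open import Data.Product using (∃-syntax; _,_; proj₁; proj₂)
open import Data.Sum using (_⊎_; inj₁; inj₂)
open import Function using (_∘_; _⇔_; mk⇔; Equivalence)
open import Function.Construct.Identity using (⇔-id)
open import Function.Construct.Symmetry using (⇔-sym)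
open import Relation.Binary.Definitions using (tri<; tri≈; tri>)
open import Relation.Nullary using (Dec; yes; no; ¬_; ⌊_⌋; contradiction)
open import Relation.Nullary.Decidable using (_×-dec_)
open import Relation.Binary.PropositionalEquality
  using (_≡_; _≢_; refl; sym; trans; cong; cong₂; subst; subst₂; module ≡-Reasoning)

private
  variable
    a b : Level
    A : Set a
    B : Set b
    n m : ℕ

⌊⌋-yes : (a? : Dec A) → A → ⌊ a? ⌋ ≡ true
⌊⌋-yes (yes _) _ = refl
⌊⌋-yes (no ¬a) a = contradiction a ¬a

⌊⌋-no : (a? : Dec A) → ¬ A → ⌊ a? ⌋ ≡ false
⌊⌋-no (yes a) ¬a = contradiction a ¬a
⌊⌋-no (no _) _ = refl

⌊⌋-⇔ : (A → B) → (B → A) → (a? : Dec A) (b? : Dec B) → ⌊ a? ⌋ ≡ ⌊ b? ⌋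
⌊⌋-⇔ to from (yes a) b? = sym (⌊⌋-yes b? (to a))
⌊⌋-⇔ to from (no ¬a) b? = sym (⌊⌋-no b? (¬a ∘ from))

⌊⌋-complement : (A → ¬ B) → (¬ B → A) → (a? : Dec A) (b? : Dec B) → ⌊ a? ⌋ ≡ not ⌊ b? ⌋
⌊⌋-complement to from (yes a) (yes b) = contradiction b (to a)
⌊⌋-complement to from (yes a) (no _) = refl
⌊⌋-complement to from (no _) (yes _) = refl
⌊⌋-complement to from (no ¬a) (no ¬b) = contradiction (from ¬b) ¬a

lookup-ext : {v w : Vec A m} → (∀ i → lookup v i ≡ lookup w i) → v ≡ w
lookup-ext {v = v} {w} eq = begin
  v                   ≡⟨ Vecₚ.tabulate∘lookup v ⟨
  tabulate (lookup v) ≡⟨ Vecₚ.tabulate-cong eq ⟩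
  tabulate (lookup w) ≡⟨ Vecₚ.tabulate∘lookup w ⟩
  w                   ∎
  where open ≡-Reasoning

infixl 7 _∘ₚ_
_∘ₚ_ : Perm n → Perm n → Perm n
u ∘ₚ v = compose u v , λ i j eq →
  proj₂ v i j (proj₂ u _ _ (trans (sym (app-compose i)) (trans eq (app-compose j))))
  where app-compose = Vecₚ.lookup∘tabulate (λ i → app u (app v i))

app-∘ₚ : (u v : Perm n) (i : Fin n) → app (u ∘ₚ v) i ≡ app u (app v i)
app-∘ₚ u v = Vecₚ.lookup∘tabulate _

∘ₚ-assoc : (a b d : Perm n) → proj₁ (a ∘ₚ (b ∘ₚ d)) ≡ proj₁ (a ∘ₚ b ∘ₚ d)
∘ₚ-assoc a b d = lookup-ext λ i → begin
  app (a ∘ₚ (b ∘ₚ d)) i   ≡⟨ app-∘ₚ a (b ∘ₚ d) i ⟩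
  app a (app (b ∘ₚ d) i)  ≡⟨ cong (app a) (app-∘ₚ b d i) ⟩
  app a (app b (app d i)) ≡⟨ app-∘ₚ a b (app d i) ⟨
  app (a ∘ₚ b) (app d i)  ≡⟨ app-∘ₚ (a ∘ₚ b) d i ⟨
  app (a ∘ₚ b ∘ₚ d) i     ∎
  where open ≡-Reasoning

app-injective : (g : Perm n) {i j : Fin n} → app g i ≡ app g j → i ≡ j
app-injective g = proj₂ g _ _

app-surjective : (g : Perm n) (y : Fin n) → ∃[ x ] app g x ≡ y
app-surjective {ℕ.suc n} g y with Finₚ.any? (λ x → app g x ≟ y)
... | yes hit = hit
... | no miss = contradiction (Finₚ.injective⇒≤ avoid-injective) ℕₚ.1+n≰n
  where
  -- Punching out the missed value y turns g into an injection Fin (1 + n) → Fin n.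
  missed : ∀ x → y ≢ app g x
  missed x y≡gx = miss (x , sym y≡gx)
  avoid : Fin (ℕ.suc n) → Fin n
  avoid x = Fin.punchOut (missed x)
  avoid-injective : ∀ {x x'} → avoid x ≡ avoid x' → x ≡ x'
  avoid-injective {x} {x'} = app-injective g ∘ Finₚ.punchOut-injective (missed x) (missed x')

preimage : Perm n → Fin n → Fin n
preimage g y = proj₁ (app-surjective g y)

app-preimage : (g : Perm n) (y : Fin n) → app g (preimage g y) ≡ y
app-preimage g y = proj₂ (app-surjective g y)

record Involution (n : ℕ) : Set where
  field
    apply      : Fin n → Fin n
    involutive : ∀ i → apply (apply i) ≡ i

  injective : ∀ {i j} → apply i ≡ apply j → i ≡ j
  injective {i} {j} eq = trans (sym (involutive i)) (trans (cong apply eq) (involutive j))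

infixr 9 _⟨$⟩_
_⟨$⟩_ : Involution n → Fin n → Fin n
_⟨$⟩_ = Involution.apply

precomposeVec : Involution n → Vec (Fin n) n → Vec (Fin n) n
precomposeVec σ v = tabulate (λ i → lookup v (σ ⟨$⟩ i))

postcomposeVec : Involution n → Vec (Fin n) n → Vec (Fin n) n
postcomposeVec σ v = tabulate (λ i → σ ⟨$⟩ lookup v i)

module _ (σ : Involution n) where
  open Involution σ

  precomposeVec-involutive : ∀ v → precomposeVec σ (precomposeVec σ v) ≡ v
  precomposeVec-involutive v = lookup-ext λ i →
    trans (Vecₚ.lookup∘tabulate _ i) (trans (Vecₚ.lookup∘tabulate _ (apply i)) (cong (lookup v) (involutive i)))

  postcomposeVec-involutive : ∀ v → postcomposeVec σ (postcomposeVec σ v) ≡ v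
  postcomposeVec-involutive v = lookup-ext λ i →
    trans (Vecₚ.lookup∘tabulate _ i) (trans (cong apply (Vecₚ.lookup∘tabulate _ i)) (involutive (lookup v i)))

  precomposeVec-isPerm : ∀ {v} → IsPerm v → IsPerm (precomposeVec σ v)
  precomposeVec-isPerm {v} v-perm i j eq = injective
    (v-perm _ _ (trans (sym (Vecₚ.lookup∘tabulate f i)) (trans eq (Vecₚ.lookup∘tabulate f j))))
    where f = λ i → lookup v (apply i)

  postcomposeVec-isPerm : ∀ {v} → IsPerm v → IsPerm (postcomposeVec σ v)
  postcomposeVec-isPerm {v} v-perm i j eq = v-perm i j
    (injective (trans (sym (Vecₚ.lookup∘tabulate f i)) (trans eq (Vecₚ.lookup∘tabulate f j))))
    where f = λ i → apply (lookup v i)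

infixl 7 _∘ᵢ_
_∘ᵢ_ : Perm n → Involution n → Perm n
u ∘ᵢ σ = precomposeVec σ (proj₁ u) , precomposeVec-isPerm σ {proj₁ u} (proj₂ u)

infixr 7 _ᵢ∘_
_ᵢ∘_ : Involution n → Perm n → Perm n
σ ᵢ∘ u = postcomposeVec σ (proj₁ u) , postcomposeVec-isPerm σ {proj₁ u} (proj₂ u)

app-∘ᵢ : (u : Perm n) (σ : Involution n) (i : Fin n) → app (u ∘ᵢ σ) i ≡ app u (σ ⟨$⟩ i)
app-∘ᵢ u σ = Vecₚ.lookup∘tabulate _

app-ᵢ∘ : (σ : Involution n) (u : Perm n) (i : Fin n) → app (σ ᵢ∘ u) i ≡ σ ⟨$⟩ app u i
app-ᵢ∘ σ u = Vecₚ.lookup∘tabulate _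

app-∘ᵢ-∘ᵢ : (u : Perm n) (σ : Involution n) (i : Fin n) → app (u ∘ᵢ σ ∘ᵢ σ) i ≡ app u i
app-∘ᵢ-∘ᵢ u σ i =
  trans (app-∘ᵢ (u ∘ᵢ σ) σ i) (trans (app-∘ᵢ u σ _) (cong (app u) (Involution.involutive σ i)))

app-ᵢ∘-ᵢ∘ : (σ : Involution n) (u : Perm n) (i : Fin n) → app (σ ᵢ∘ σ ᵢ∘ u) i ≡ app u i
app-ᵢ∘-ᵢ∘ σ u i =
  trans (app-ᵢ∘ σ (σ ᵢ∘ u) i) (trans (cong (σ ⟨$⟩_) (app-ᵢ∘ σ u i)) (Involution.involutive σ (app u i)))

∘ₚ-intertwined : (s t : Involution n) (b : Perm n) → (∀ i → s ⟨$⟩ app b i ≡ app b (t ⟨$⟩ i)) →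
                 ∀ a d → proj₁ (a ∘ᵢ s ∘ₚ b ∘ₚ (t ᵢ∘ d)) ≡ proj₁ (a ∘ₚ b ∘ₚ d)
∘ₚ-intertwined s t b intertwines a d = lookup-ext λ i → begin
  app (a ∘ᵢ s ∘ₚ b ∘ₚ (t ᵢ∘ d)) i        ≡⟨ app-∘ₚ (a ∘ᵢ s ∘ₚ b) (t ᵢ∘ d) i ⟩
  app (a ∘ᵢ s ∘ₚ b) (app (t ᵢ∘ d) i)     ≡⟨ app-∘ₚ (a ∘ᵢ s) b _ ⟩
  app (a ∘ᵢ s) (app b (app (t ᵢ∘ d) i))  ≡⟨ app-∘ᵢ a s _ ⟩
  app a (s ⟨$⟩ app b (app (t ᵢ∘ d) i))   ≡⟨ cong (app a) (intertwines _) ⟩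
  app a (app b (t ⟨$⟩ app (t ᵢ∘ d) i))   ≡⟨ cong (app a ∘ app b ∘ (t ⟨$⟩_)) (app-ᵢ∘ t d i) ⟩
  app a (app b (t ⟨$⟩ t ⟨$⟩ app d i))    ≡⟨ cong (app a ∘ app b) (Involution.involutive t (app d i)) ⟩
  app a (app b (app d i))                ≡⟨ app-∘ₚ a b (app d i) ⟨
  app (a ∘ₚ b) (app d i)                 ≡⟨ app-∘ₚ (a ∘ₚ b) d i ⟨
  app (a ∘ₚ b ∘ₚ d) i                    ∎
  where open ≡-Reasoning

-- Transpositions

data TransposeView {n} (a b i : Fin n) : Fin n → Set where
  at-left   : i ≡ a → TransposeView a b i b
  at-right  : i ≢ a → i ≡ b → TransposeView a b i a
  elsewhere : i ≢ a → i ≢ b → TransposeView a b i i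

transpose-view : (a b i : Fin n) → TransposeView a b i (transpose a b i)
transpose-view a b i with i ≟ a
... | yes i≡a = at-left i≡a
... | no i≢a with i ≟ b
...   | yes i≡b = at-right i≢a i≡b
...   | no i≢b = elsewhere i≢a i≢b

transpose-matchˡ : (a b : Fin n) → transpose a b a ≡ b
transpose-matchˡ a b with transpose a b a | transpose-view a b a
... | _ | at-left _ = refl
... | _ | at-right a≢a _ = contradiction refl a≢a
... | _ | elsewhere a≢a _ = contradiction refl a≢a

transpose-matchʳ : (a b : Fin n) → transpose a b b ≡ a
transpose-matchʳ a b with transpose a b b | transpose-view a b b
... | _ | at-left b≡a = b≡a
... | _ | at-right _ _ = refl
... | _ | elsewhere _ b≢b = contradiction refl b≢b

transpose-fixed : (a b : Fin n) {i : Fin n} → i ≢ a → i ≢ b → transpose a b i ≡ i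
transpose-fixed a b {i} i≢a i≢b with transpose a b i | transpose-view a b i
... | _ | at-left i≡a = contradiction i≡a i≢a
... | _ | at-right _ i≡b = contradiction i≡b i≢b
... | _ | elsewhere _ _ = refl

transpose-involutive : (a b i : Fin n) → transpose a b (transpose a b i) ≡ i
transpose-involutive a b i with transpose a b i | transpose-view a b i
... | _ | at-left refl = transpose-matchʳ a b
... | _ | at-right _ refl = transpose-matchˡ a b
... | _ | elsewhere i≢a i≢b = transpose-fixed a b i≢a i≢b

transpose-comm : (a b i : Fin n) → transpose a b i ≡ transpose b a i
transpose-comm a b i with transpose a b i | transpose-view a b i
... | _ | at-left refl = sym (transpose-matchʳ b a)
... | _ | at-right _ refl = sym (transpose-matchˡ b a)
... | _ | elsewhere i≢a i≢b = sym (transpose-fixed b a i≢b i≢a)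

transpose-conjugate : (g : Fin n → Fin n) → (∀ {i j} → g i ≡ g j → i ≡ j) →
                      (a b i : Fin n) → transpose (g a) (g b) (g i) ≡ g (transpose a b i)
transpose-conjugate g g-injective a b i with transpose a b i | transpose-view a b i
... | _ | at-left refl = transpose-matchˡ (g a) (g b)
... | _ | at-right _ refl = transpose-matchʳ (g a) (g b)
... | _ | elsewhere i≢a i≢b = transpose-fixed (g a) (g b) (i≢a ∘ g-injective) (i≢b ∘ g-injective)

transposition : Fin n → Fin n → Involution n
transposition a b = record { apply = transpose a b ; involutive = transpose-involutive a b }

-- (a b) is the conjugate of (a c) by (c b).
ᵢ∘-transposition-via : (a b c : Fin n) → a ≢ c → a ≢ b → (g : Perm n) → ∀ i →
  app (transposition a b ᵢ∘ g) i ≡ app (transposition c b ᵢ∘ transposition a c ᵢ∘ transposition c b ᵢ∘ g) i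
ᵢ∘-transposition-via a b c a≢c a≢b g i = begin
  app (transposition a b ᵢ∘ g) i              ≡⟨ app-ᵢ∘ (transposition a b) g i ⟩
  transpose a b (app g i)                     ≡⟨ cong₂ (λ x y → transpose x y (app g i)) (sym ha≡a) (sym hc≡b) ⟩
  transpose (h a) (h c) (app g i)             ≡⟨ cong (transpose (h a) (h c)) (transpose-involutive c b (app g i)) ⟨
  transpose (h a) (h c) (h (h (app g i)))     ≡⟨ transpose-conjugate h (Involution.injective t-cb) a c (h (app g i)) ⟩
  h (transpose a c (h (app g i)))             ≡⟨ cong (λ j → h (transpose a c j)) (app-ᵢ∘ t-cb g i) ⟨
  h (transpose a c (app (t-cb ᵢ∘ g) i))       ≡⟨ cong h (app-ᵢ∘ (transposition a c) (t-cb ᵢ∘ g) i) ⟨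
  h (app (transposition a c ᵢ∘ t-cb ᵢ∘ g) i)  ≡⟨ app-ᵢ∘ t-cb (transposition a c ᵢ∘ t-cb ᵢ∘ g) i ⟨
  app (t-cb ᵢ∘ transposition a c ᵢ∘ t-cb ᵢ∘ g) i ∎
  where
  open ≡-Reasoning
  t-cb = transposition c b
  h = transpose c b
  ha≡a = transpose-fixed c b a≢c a≢b
  hc≡b = transpose-matchˡ c b

∘ᵢ-transposition : (u : Perm n) (p q : Fin n) →
  ∀ i → app (u ∘ᵢ transposition p q) i ≡ app (transposition (app u p) (app u q) ᵢ∘ u) i
∘ᵢ-transposition u p q i = begin
  app (u ∘ᵢ transposition p q) i                    ≡⟨ app-∘ᵢ u (transposition p q) i ⟩
  app u (transpose p q i)                           ≡⟨ transpose-conjugate (app u) (app-injective u) p q i ⟨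
  transpose (app u p) (app u q) (app u i)           ≡⟨ app-ᵢ∘ (transposition (app u p) (app u q)) u i ⟨
  app (transposition (app u p) (app u q) ᵢ∘ u) i    ∎
  where open ≡-Reasoning

enumerate : (U : Subset n) → Fin ∣ U ∣ → Fin n
enumerate (true  ∷ U) Fin.zero    = Fin.zero
enumerate (true  ∷ U) (Fin.suc i) = Fin.suc (enumerate U i)
enumerate (false ∷ U) i           = Fin.suc (enumerate U i)

enumerate-∈ : (U : Subset n) (i : Fin ∣ U ∣) → enumerate U i ∈ U
enumerate-∈ (true  ∷ U) Fin.zero    = Vec.here
enumerate-∈ (true  ∷ U) (Fin.suc i) = Vec.there (enumerate-∈ U i)
enumerate-∈ (false ∷ U) i           = Vec.there (enumerate-∈ U i)

enumerate-injective : (U : Subset n) {i j : Fin ∣ U ∣} → enumerate U i ≡ enumerate U j → i ≡ j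
enumerate-injective (true  ∷ U) {Fin.zero}  {Fin.zero}  _  = refl
enumerate-injective (true  ∷ U) {Fin.suc i} {Fin.suc j} eq =
  cong Fin.suc (enumerate-injective U (Finₚ.suc-injective eq))
enumerate-injective (false ∷ U) eq = enumerate-injective U (Finₚ.suc-injective eq)

record Collision (U : Subset n) (f : Fin n → Fin m) : Set where
  field
    p q      : Fin n
    p≢q      : p ≢ q
    p∈U      : p ∈ U
    q∈U      : q ∈ U
    collides : f p ≡ f q

subset-pigeonhole : (U : Subset n) → m ℕ.< ∣ U ∣ → (f : Fin n → Fin m) → Collision U f
subset-pigeonhole U m<∣U∣ f with Finₚ.pigeonhole m<∣U∣ (f ∘ enumerate U)
... | i , j , i<j , fi≡fj = record
  { p = enumerate U i ; q = enumerate U j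
  ; p≢q = Finₚ.<⇒≢ i<j ∘ enumerate-injective U
  ; p∈U = enumerate-∈ U i ; q∈U = enumerate-∈ U j
  ; collides = fi≡fj }

concatMap-map≡cartesianProductWith : ∀ {c} {C : Set c} (f : A → B → C) (xs : List A) (ys : List B) →
  concatMap (λ x → map (f x) ys) xs ≡ cartesianProductWith f xs ys
concatMap-map≡cartesianProductWith f []       ys = refl
concatMap-map≡cartesianProductWith f (x ∷ xs) ys =
  cong (map (f x) ys ++_) (concatMap-map≡cartesianProductWith f xs ys)

allVecs-suc : (n m : ℕ) → allVecs n (ℕ.suc m) ≡ cartesianProductWith _∷_ (allFin n) (allVecs n m)
allVecs-suc n m = concatMap-map≡cartesianProductWith _∷_ (allFin n) (allVecs n m)

allVecs-unique : (n m : ℕ) → Unique (allVecs n m)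
allVecs-unique n ℕ.zero    = [] ∷ []
allVecs-unique n (ℕ.suc m) = subst Unique (sym (allVecs-suc n m))
  (Uniqueₚ.cartesianProductWith⁺ _∷_ Vecₚ.∷-injective (Uniqueₚ.allFin⁺ n) (allVecs-unique n m))

∈-allVecs : (v : Vec (Fin n) m) → v ∈ₗ allVecs n m
∈-allVecs []      = here refl
∈-allVecs {n} {ℕ.suc m} (i ∷ v) = subst ((i ∷ v) ∈ₗ_) (sym (allVecs-suc n m))
  (Membershipₚ.∈-cartesianProductWith⁺ _∷_ (Membershipₚ.∈-allFin i) (∈-allVecs v))

_≟ᵥ_ : (v w : Vec (Fin n) m) → Dec (v ≡ w)
_≟ᵥ_ = Vecₚ.≡-dec _≟_

-- Inversions

module _ {A : Set} {P Q : A → Set} (P? : ∀ x → Dec (P x)) (Q? : ∀ x → Dec (Q x)) where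

  length-filter-≐ : {L : List A} → All (λ x → P x ⇔ Q x) L →
                    length (filter P? L) ≡ length (filter Q? L)
  length-filter-≐ [] = refl
  length-filter-≐ {x ∷ L} (P⇔Q ∷ agree) with P? x | Q? x
  ... | yes _  | yes _  = cong ℕ.suc (length-filter-≐ agree)
  ... | no _   | no _   = length-filter-≐ agree
  ... | yes px | no ¬qx = contradiction (Equivalence.to P⇔Q px) ¬qx
  ... | no ¬px | yes qx = contradiction (Equivalence.from P⇔Q qx) ¬px

  length-filter-flip : {L : List A} {e : A} → Unique L → e ∈ₗ L → (∀ {x} → x ≢ e → P x ⇔ Q x) →
                       P e → ¬ Q e → length (filter P? L) ≡ ℕ.suc (length (filter Q? L))
  length-filter-flip {x ∷ L} (x∉L ∷ unique) (here refl) agree Pe ¬Qe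
    rewrite Listₚ.filter-accept P? {xs = L} Pe | Listₚ.filter-reject Q? {xs = L} ¬Qe =
    cong ℕ.suc (length-filter-≐ (All.map (λ e≢y → agree (e≢y ∘ sym)) x∉L))
  length-filter-flip {x ∷ L} (x∉L ∷ unique) (there e∈L) agree Pe ¬Qe with P? x | Q? x
  ... | yes _  | yes _  = cong ℕ.suc (length-filter-flip unique e∈L agree Pe ¬Qe)
  ... | no _   | no _   = length-filter-flip unique e∈L agree Pe ¬Qe
  ... | yes px | no ¬qx = contradiction (Equivalence.to (agree x≢e) px) ¬qx
    where x≢e = All.lookup x∉L e∈L
  ... | no ¬px | yes qx = contradiction (Equivalence.from (agree x≢e) qx) ¬px
    where x≢e = All.lookup x∉L e∈L

pairs : (n : ℕ) → List (Fin n × Fin n)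
pairs n = concatMap (λ i → map (i ,_) (allFin n)) (allFin n)

pairs≡cartesianProduct : (n : ℕ) → pairs n ≡ cartesianProductWith _,_ (allFin n) (allFin n)
pairs≡cartesianProduct n = concatMap-map≡cartesianProductWith _,_ (allFin n) (allFin n)

pairs-unique : (n : ℕ) → Unique (pairs n)
pairs-unique n = subst Unique (sym (pairs≡cartesianProduct n))
  (Uniqueₚ.cartesianProduct⁺ (Uniqueₚ.allFin⁺ n) (Uniqueₚ.allFin⁺ n))

∈-pairs : (i j : Fin n) → (i , j) ∈ₗ pairs n
∈-pairs {n} i j = subst ((i , j) ∈ₗ_) (sym (pairs≡cartesianProduct n))
  (Membershipₚ.∈-cartesianProduct⁺ (Membershipₚ.∈-allFin i) (Membershipₚ.∈-allFin j))

-- inversions g unfolds to length (filter (isInversion? g) (pairs n)).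
IsInversion : Perm n → Fin n × Fin n → Set
IsInversion g p = proj₁ p < proj₂ p × app g (proj₂ p) < app g (proj₁ p)

isInversion? : (g : Perm n) (p : Fin n × Fin n) → Dec (IsInversion g p)
isInversion? g p = (proj₁ p <? proj₂ p) ×-dec (app g (proj₂ p) <? app g (proj₁ p))

below-adjacent : ∀ {k k' y} → k' ≡ ℕ.suc k → y ≢ k → (y ℕ.< k ⇔ y ℕ.< k')
below-adjacent refl y≢k = mk⇔ ℕₚ.m<n⇒m<1+n (λ y<1+k → ℕₚ.≤∧≢⇒< (ℕ.s≤s⁻¹ y<1+k) y≢k)

above-adjacent : ∀ {k k' x} → k' ≡ ℕ.suc k → x ≢ k' → (k ℕ.< x ⇔ k' ℕ.< x)
above-adjacent {k} refl x≢k' =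
  mk⇔ (λ k<x → ℕₚ.≤∧≢⇒< k<x (x≢k' ∘ sym)) (ℕₚ.<-trans (ℕₚ.n<1+n k))

transpose-adjacent-order : (k k' : Fin n) → toℕ k' ≡ ℕ.suc (toℕ k) → {x y : Fin n} → x ≢ y →
  ¬ (x ≡ k × y ≡ k') → ¬ (x ≡ k' × y ≡ k) → (y < x ⇔ transpose k k' y < transpose k k' x)
transpose-adjacent-order k k' adjacent {x} {y} x≢y ¬kk' ¬k'k
  with transpose k k' x | transpose-view k k' x | transpose k k' y | transpose-view k k' y
... | _ | at-left x≡k      | _ | at-left y≡k      = contradiction (trans x≡k (sym y≡k)) x≢y
... | _ | at-left x≡k      | _ | at-right _ y≡k'  = contradiction (x≡k , y≡k') ¬kk'
... | _ | at-left refl     | _ | elsewhere y≢k _  = below-adjacent adjacent (y≢k ∘ Finₚ.toℕ-injective)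
... | _ | at-right _ x≡k'  | _ | at-left y≡k      = contradiction (x≡k' , y≡k) ¬k'k
... | _ | at-right _ x≡k'  | _ | at-right _ y≡k'  = contradiction (trans x≡k' (sym y≡k')) x≢y
... | _ | at-right _ refl  | _ | elsewhere y≢k _  = ⇔-sym (below-adjacent adjacent (y≢k ∘ Finₚ.toℕ-injective))
... | _ | elsewhere _ x≢k' | _ | at-left refl     = above-adjacent adjacent (x≢k' ∘ Finₚ.toℕ-injective)
... | _ | elsewhere _ x≢k' | _ | at-right _ refl  = ⇔-sym (above-adjacent adjacent (x≢k' ∘ Finₚ.toℕ-injective))
... | _ | elsewhere _ _    | _ | elsewhere _ _    = ⇔-id _

<⇒distance : {a b : Fin n} → a < b → ∃[ d ] toℕ b ≡ ℕ.suc (d ℕ.+ toℕ a)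
<⇒distance {a = a} a<b with ℕₚ.m≤n⇒∃[o]m+o≡n a<b
... | d , 1+a+d≡b = d , trans (sym 1+a+d≡b) (cong ℕ.suc (ℕₚ.+-comm (toℕ a) d))

-- Swapping the adjacent values k and k' changes the inversion status of exactly one pair of
-- positions, the one carrying k and k'.
module _ (k k' : Fin n) (adjacent : toℕ k' ≡ ℕ.suc (toℕ k)) (g : Perm n) where
  private
    h = transposition k k' ᵢ∘ g

    k<k' : k < k'
    k<k' = subst (toℕ k ℕ.<_) (sym adjacent) (ℕₚ.n<1+n (toℕ k))

    app-h : ∀ i → app h i ≡ transpose k k' (app g i)
    app-h = app-ᵢ∘ (transposition k k') g

    x = preimage g k
    x' = preimage g k'

    gx≡k : app g x ≡ k
    gx≡k = app-preimage g k

    gx'≡k' : app g x' ≡ k'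
    gx'≡k' = app-preimage g k'

    hx≡k' : app h x ≡ k'
    hx≡k' = trans (app-h x) (trans (cong (transpose k k') gx≡k) (transpose-matchˡ k k'))

    hx'≡k : app h x' ≡ k
    hx'≡k = trans (app-h x') (trans (cong (transpose k k') gx'≡k') (transpose-matchʳ k k'))

    carried : ∀ {i} → app g i ≡ k → i ≡ x
    carried gi≡k = app-injective g (trans gi≡k (sym gx≡k))

    carried' : ∀ {i} → app g i ≡ k' → i ≡ x'
    carried' gi≡k' = app-injective g (trans gi≡k' (sym gx'≡k'))

    inversion-agrees : ∀ {i j} → (i < j → (i , j) ≢ (x , x')) → (i < j → (i , j) ≢ (x' , x)) →
                       IsInversion g (i , j) ⇔ IsInversion h (i , j)
    inversion-agrees {i} {j} ≢xx' ≢x'x = mk⇔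
      (λ (i<j , gj<gi) → i<j ,
        subst₂ _<_ (sym (app-h j)) (sym (app-h i)) (Equivalence.to (order i<j) gj<gi))
      (λ (i<j , hj<hi) → i<j , Equivalence.from (order i<j) (subst₂ _<_ (app-h j) (app-h i) hj<hi))
      where
      order : i < j → app g j < app g i ⇔ transpose k k' (app g j) < transpose k k' (app g i)
      order i<j = transpose-adjacent-order k k' adjacent (Finₚ.<⇒≢ i<j ∘ app-injective g)
        (λ (gi≡k , gj≡k') → ≢xx' i<j (cong₂ _,_ (carried gi≡k) (carried' gj≡k')))
        (λ (gi≡k' , gj≡k) → ≢x'x i<j (cong₂ _,_ (carried' gi≡k') (carried gj≡k)))

    unordered : ∀ {a b i j : Fin n} → a < b → i < j → (i , j) ≢ (b , a)
    unordered a<b i<j refl = Finₚ.<-asym a<b i<j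

  inversions-adjacent : inversions g ≡ ℕ.suc (inversions h) ⊎ inversions h ≡ ℕ.suc (inversions g)
  inversions-adjacent with Finₚ.<-cmp x x'
  ... | tri< x<x' _ _ = inj₂ (length-filter-flip (isInversion? h) (isInversion? g)
    (pairs-unique n) (∈-pairs x x')
    (λ ≢xx' → ⇔-sym (inversion-agrees (λ _ → ≢xx') (unordered x<x')))
    (x<x' , subst₂ _<_ (sym hx'≡k) (sym hx≡k') k<k')
    (λ (_ , gx'<gx) → Finₚ.<-asym k<k' (subst₂ _<_ gx'≡k' gx≡k gx'<gx)))
  ... | tri≈ _ x≡x' _ = contradiction (trans (sym gx≡k) (trans (cong (app g) x≡x') gx'≡k')) (Finₚ.<⇒≢ k<k')
  ... | tri> _ _ x'<x = inj₁ (length-filter-flip (isInversion? g) (isInversion? h)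
    (pairs-unique n) (∈-pairs x' x)
    (λ ≢x'x → inversion-agrees (unordered x'<x) (λ _ → ≢x'x))
    (x'<x , subst₂ _<_ (sym gx≡k) (sym gx'≡k') k<k')
    (λ (_ , hx<hx') → Finₚ.<-asym k<k' (subst₂ _<_ hx≡k' hx'≡k hx<hx')))

FixesOutsideᵢ : Subset n → Involution n → Set
FixesOutsideᵢ U σ = ∀ i → i ∉ U → σ ⟨$⟩ i ≡ i

transposition-fixesOutside : {U : Subset n} {p q : Fin n} → p ∈ U → q ∈ U →
                             FixesOutsideᵢ U (transposition p q)
transposition-fixesOutside {p = p} {q} p∈U q∈U i i∉U =
  transpose-fixed p q (λ { refl → i∉U p∈U }) (λ { refl → i∉U q∈U })

module _ {U : Subset n} {σ : Involution n} (σ-fixes : FixesOutsideᵢ U σ) where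

  fixesOutside-ᵢ∘ : (v : Perm n) → FixesOutside U (σ ᵢ∘ v) ⇔ FixesOutside U v
  fixesOutside-ᵢ∘ v = mk⇔
    (λ fixes i i∉U → begin
      app v i               ≡⟨ Involution.involutive σ (app v i) ⟨
      σ ⟨$⟩ σ ⟨$⟩ app v i   ≡⟨ cong (σ ⟨$⟩_) (app-ᵢ∘ σ v i) ⟨
      σ ⟨$⟩ app (σ ᵢ∘ v) i  ≡⟨ cong (σ ⟨$⟩_) (fixes i i∉U) ⟩
      σ ⟨$⟩ i               ≡⟨ σ-fixes i i∉U ⟩
      i                     ∎)
    (λ fixes i i∉U → trans (app-ᵢ∘ σ v i) (trans (cong (σ ⟨$⟩_) (fixes i i∉U)) (σ-fixes i i∉U)))
    where open ≡-Reasoning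

  fixesOutside-∘ᵢ : (u : Perm n) → FixesOutside U (u ∘ᵢ σ) ⇔ FixesOutside U u
  fixesOutside-∘ᵢ u = mk⇔
    (λ fixes i i∉U →
      trans (cong (app u) (sym (σ-fixes i i∉U))) (trans (sym (app-∘ᵢ u σ i)) (fixes i i∉U)))
    (λ fixes i i∉U → trans (app-∘ᵢ u σ i) (trans (cong (app u) (σ-fixes i i∉U)) (fixes i i∉U)))

PreservesBlocks : Involution n → SetComp n m → Set
PreservesBlocks σ 𝐀 = ∀ j {x} → x ∈ block 𝐀 j → σ ⟨$⟩ x ∈ block 𝐀 j

block-unique : (𝐀 : SetComp n m) {j j' : Fin m} {x : Fin n} →
               x ∈ block 𝐀 j → x ∈ block 𝐀 j' → j ≡ j'
block-unique 𝐀 {j} {j'} x∈j x∈j' with j ≟ j'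
... | yes j≡j' = j≡j'
... | no j≢j' = ⊥-elim (disjoint 𝐀 j j' j≢j' (_ , Subsetₚ.x∈p∩q⁺ (x∈j , x∈j')))

transposition-preservesBlocks : (𝐀 : SetComp n m) {j : Fin m} {α β : Fin n} →
  α ∈ block 𝐀 j → β ∈ block 𝐀 j → PreservesBlocks (transposition α β) 𝐀
transposition-preservesBlocks 𝐀 {j} {α} {β} α∈j β∈j j' {x} x∈j'
  with transpose α β x | transpose-view α β x
... | _ | at-left refl   = subst (λ j → β ∈ block 𝐀 j) (block-unique 𝐀 α∈j x∈j') β∈j
... | _ | at-right _ refl = subst (λ j → α ∈ block 𝐀 j) (block-unique 𝐀 β∈j x∈j') α∈j
... | _ | elsewhere _ _  = x∈j'

module _ {𝐀 𝐁 : SetComp n m} where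

  mapsComp-pointwise : {u u' : Perm n} → (∀ i → app u i ≡ app u' i) →
                       MapsComp u 𝐀 𝐁 → MapsComp u' 𝐀 𝐁
  mapsComp-pointwise u≗u' maps j y =
    (λ y∈B → let x , x∈A , ux≡y = proj₁ (maps j y) y∈B in x , x∈A , trans (sym (u≗u' x)) ux≡y)
    , (λ (x , x∈A , u'x≡y) → proj₂ (maps j y) (x , x∈A , trans (u≗u' x) u'x≡y))

  mapsComp-∘ᵢ : {σ : Involution n} → PreservesBlocks σ 𝐀 → (u : Perm n) →
                MapsComp u 𝐀 𝐁 → MapsComp (u ∘ᵢ σ) 𝐀 𝐁
  mapsComp-∘ᵢ {σ} σ-preserves u maps j y =
    (λ y∈B → let x , x∈A , ux≡y = proj₁ (maps j y) y∈B in
      σ ⟨$⟩ x , σ-preserves j x∈A ,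
      trans (app-∘ᵢ u σ _) (trans (cong (app u) (Involution.involutive σ x)) ux≡y))
    , (λ (x , x∈A , uσx≡y) →
      proj₂ (maps j y) (σ ⟨$⟩ x , σ-preserves j x∈A , trans (sym (app-∘ᵢ u σ x)) uσx≡y))

  mapsComp-ᵢ∘ : {σ : Involution n} → PreservesBlocks σ 𝐁 → (u : Perm n) →
                MapsComp u 𝐀 𝐁 → MapsComp (σ ᵢ∘ u) 𝐀 𝐁
  mapsComp-ᵢ∘ {σ} σ-preserves u maps j y =
    (λ y∈B → let x , x∈A , ux≡σy = proj₁ (maps j (σ ⟨$⟩ y)) (σ-preserves j y∈B) in
      x , x∈A , trans (app-ᵢ∘ σ u x) (trans (cong (σ ⟨$⟩_) ux≡σy) (Involution.involutive σ y)))
    , (λ (x , x∈A , σux≡y) → subst (_∈ block 𝐁 j) (trans (sym (app-ᵢ∘ σ u x)) σux≡y)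
        (σ-preserves j (proj₂ (maps j (app u x)) (x , x∈A , refl))))

  mapsComp-∘ᵢ-⇔ : {σ : Involution n} → PreservesBlocks σ 𝐀 → (u : Perm n) →
                  MapsComp (u ∘ᵢ σ) 𝐀 𝐁 ⇔ MapsComp u 𝐀 𝐁
  mapsComp-∘ᵢ-⇔ {σ} σ-preserves u = mk⇔
    (mapsComp-pointwise {u ∘ᵢ σ ∘ᵢ σ} {u} (app-∘ᵢ-∘ᵢ u σ)
      ∘ mapsComp-∘ᵢ {σ} σ-preserves (u ∘ᵢ σ))
    (mapsComp-∘ᵢ {σ} σ-preserves u)

  mapsComp-ᵢ∘-⇔ : {σ : Involution n} → PreservesBlocks σ 𝐁 → (u : Perm n) →
                  MapsComp (σ ᵢ∘ u) 𝐀 𝐁 ⇔ MapsComp u 𝐀 𝐁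
  mapsComp-ᵢ∘-⇔ {σ} σ-preserves u = mk⇔
    (mapsComp-pointwise {σ ᵢ∘ σ ᵢ∘ u} {u} (app-ᵢ∘-ᵢ∘ σ u)
      ∘ mapsComp-ᵢ∘ {σ} σ-preserves (σ ᵢ∘ u))
    (mapsComp-ᵢ∘ {σ} σ-preserves u)

module GroupAlgebraLemmas {c ℓ} (R : CommutativeRing c ℓ) where
  open CommutativeRing R renaming (refl to ≈-refl; sym to ≈-sym; trans to ≈-trans)
  open GroupAlgebra R
  open import Algebra.Properties.Ring ring
    using (-‿involutive; -‿distribˡ-*; -‿distribʳ-*; -0#≈0#; -‿+-comm)
  open import Algebra.Properties.CommutativeSemigroup *-commutativeSemigroup using (xy∙z≈y∙xz)
  open import Algebra.Properties.CommutativeSemigroup +-commutativeSemigroup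
    using () renaming (interchange to +-interchange)
  open import Relation.Binary.Reasoning.Setoid setoid

  infixr 8 [_]*_
  [_]*_ : Bool → Carrier → Carrier
  [ b ]* x = if b then x else 0#

  []*-cong : ∀ b {x y} → x ≈ y → [ b ]* x ≈ [ b ]* y
  []*-cong true  x≈y = x≈y
  []*-cong false _   = ≈-refl

  []*-zero : ∀ b → [ b ]* 0# ≈ 0#
  []*-zero true  = ≈-refl
  []*-zero false = ≈-refl

  []*-*ˡ : ∀ b x y → x * [ b ]* y ≈ [ b ]* (x * y)
  []*-*ˡ true  x y = ≈-refl
  []*-*ˡ false x y = zeroʳ x

  []*-*ʳ : ∀ b x y → ([ b ]* x) * y ≈ [ b ]* (x * y)
  []*-*ʳ true  x y = ≈-refl
  []*-*ʳ false x y = zeroˡ y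

  []*-neg : ∀ b x → [ b ]* (- x) ≈ - [ b ]* x
  []*-neg true  x = ≈-refl
  []*-neg false x = ≈-sym -0#≈0#

  []*-comm : ∀ b b' x → [ b ]* [ b' ]* x ≡ [ b' ]* [ b ]* x
  []*-comm true  b' x = refl
  []*-comm false true  x = refl
  []*-comm false false x = refl

  []*-split : ∀ b x → x ≈ [ b ]* x + [ not b ]* x
  []*-split true  x = ≈-sym (+-identityʳ x)
  []*-split false x = ≈-sym (+-identityˡ x)

  ∑ : List A → (A → Carrier) → Carrier
  ∑ L f = foldr _+_ 0# (map f L)

  ∑-cong : (L : List A) {f g : A → Carrier} → (∀ x → f x ≈ g x) → ∑ L f ≈ ∑ L g
  ∑-cong []      f≈g = ≈-refl
  ∑-cong (x ∷ L) f≈g = +-cong (f≈g x) (∑-cong L f≈g)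

  ∑-zero : (L : List A) → ∑ L (λ _ → 0#) ≈ 0#
  ∑-zero []      = ≈-refl
  ∑-zero (x ∷ L) = ≈-trans (+-identityˡ _) (∑-zero L)

  ∑-zero-pointwise : (L : List A) {f : A → Carrier} → (∀ x → f x ≈ 0#) → ∑ L f ≈ 0#
  ∑-zero-pointwise L f≈0 = ≈-trans (∑-cong L f≈0) (∑-zero L)

  ∑-+ : (L : List A) (f g : A → Carrier) → ∑ L (λ x → f x + g x) ≈ ∑ L f + ∑ L g
  ∑-+ []      f g = ≈-sym (+-identityˡ 0#)
  ∑-+ (x ∷ L) f g = ≈-trans (+-congˡ (∑-+ L f g)) (+-interchange (f x) (g x) (∑ L f) (∑ L g))

  ∑-*ˡ : (L : List A) (k : Carrier) (f : A → Carrier) → k * ∑ L f ≈ ∑ L (λ x → k * f x)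
  ∑-*ˡ []      k f = zeroʳ k
  ∑-*ˡ (x ∷ L) k f = ≈-trans (distribˡ k _ _) (+-congˡ (∑-*ˡ L k f))

  ∑-*ʳ : (L : List A) (k : Carrier) (f : A → Carrier) → ∑ L f * k ≈ ∑ L (λ x → f x * k)
  ∑-*ʳ []      k f = zeroˡ k
  ∑-*ʳ (x ∷ L) k f = ≈-trans (distribʳ k _ _) (+-congˡ (∑-*ʳ L k f))

  ∑-neg : (L : List A) (f : A → Carrier) → ∑ L (λ x → - f x) ≈ - ∑ L f
  ∑-neg []      f = ≈-sym -0#≈0#
  ∑-neg (x ∷ L) f = ≈-trans (+-congˡ (∑-neg L f)) (-‿+-comm _ _)

  ∑-[]* : (L : List A) (b : Bool) (f : A → Carrier) → ∑ L (λ x → [ b ]* f x) ≈ [ b ]* ∑ L f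
  ∑-[]* L true  f = ≈-refl
  ∑-[]* L false f = ∑-zero L

  ∑-comm : (L : List A) (M : List B) (f : A → B → Carrier) →
           ∑ L (λ x → ∑ M (f x)) ≈ ∑ M (λ y → ∑ L (λ x → f x y))
  ∑-comm []      M f = ≈-sym (∑-zero M)
  ∑-comm (x ∷ L) M f = ≈-trans (+-congˡ (∑-comm L M f)) (≈-sym (∑-+ M _ _))

  ∑-map : (g : A → B) (L : List A) (f : B → Carrier) → ∑ (map g L) f ≡ ∑ L (f ∘ g)
  ∑-map g []      f = refl
  ∑-map g (x ∷ L) f = cong (f (g x) +_) (∑-map g L f)

  ∑-zero-All : {L : List A} {f : A → Carrier} → All (λ x → f x ≈ 0#) L → ∑ L f ≈ 0#
  ∑-zero-All []            = ≈-refl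
  ∑-zero-All (fx≈0 ∷ rest) = ≈-trans (+-cong fx≈0 (∑-zero-All rest)) (+-identityˡ 0#)

  module _ {A : Set a} (_≟ₐ_ : (x y : A) → Dec (x ≡ y)) where

    ∑-δ : {L : List A} {x : A} → Unique L → x ∈ₗ L → (g : A → Carrier) →
          ∑ L (λ y → [ ⌊ y ≟ₐ x ⌋ ]* g y) ≈ g x
    ∑-δ {y ∷ L} (y∉L ∷ _) (here refl) g = begin
      [ ⌊ y ≟ₐ y ⌋ ]* g y + ∑ L (λ z → [ ⌊ z ≟ₐ y ⌋ ]* g z)
        ≈⟨ +-cong (reflexive (cong ([_]* g y) (⌊⌋-yes (y ≟ₐ y) refl)))
                  (∑-zero-All (All.map (λ y≢z → reflexive (cong ([_]* _) (⌊⌋-no (_ ≟ₐ y) (y≢z ∘ sym))))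
                                       y∉L)) ⟩
      g y + 0# ≈⟨ +-identityʳ (g y) ⟩
      g y      ∎
    ∑-δ {y ∷ L} {x} (y∉L ∷ unique) (there x∈L) g = begin
      [ ⌊ y ≟ₐ x ⌋ ]* g y + ∑ L (λ z → [ ⌊ z ≟ₐ x ⌋ ]* g z)
        ≈⟨ +-cong (reflexive (cong ([_]* g y) (⌊⌋-no (y ≟ₐ x) (All.lookup y∉L x∈L))))
                  (∑-δ unique x∈L g) ⟩
      0# + g x ≈⟨ +-identityˡ (g x) ⟩
      g x      ∎

    -- Double counting of the pairs (x , ρ x).
    ∑-involution : {L : List A} → Unique L → (∀ x → x ∈ₗ L) →
                   (ρ : A → A) → (∀ x → ρ (ρ x) ≡ x) →
                   (f : A → Carrier) → ∑ L (f ∘ ρ) ≈ ∑ L f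
    ∑-involution {L} unique complete ρ ρ-involutive f = begin
      ∑ L (f ∘ ρ)                                   ≈⟨ ∑-cong L (λ x → ∑-δ unique (complete (ρ x)) f) ⟨
      ∑ L (λ x → ∑ L (λ y → [ ⌊ y ≟ₐ ρ x ⌋ ]* f y)) ≈⟨ ∑-comm L L _ ⟩
      ∑ L (λ y → ∑ L (λ x → [ ⌊ y ≟ₐ ρ x ⌋ ]* f y))
        ≈⟨ ∑-cong L (λ y → ∑-cong L (λ x → reflexive (cong ([_]* f y) (swap-sides y x)))) ⟩
      ∑ L (λ y → ∑ L (λ x → [ ⌊ x ≟ₐ ρ y ⌋ ]* f y))
        ≈⟨ ∑-cong L (λ y → ∑-δ unique (complete (ρ y)) (λ _ → f y)) ⟩
      ∑ L f                                         ∎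
      where
      swap-sides : ∀ y x → ⌊ y ≟ₐ ρ x ⌋ ≡ ⌊ x ≟ₐ ρ y ⌋
      swap-sides y x = ⌊⌋-⇔ (λ y≡ρx → trans (sym (ρ-involutive x)) (cong ρ (sym y≡ρx)))
                            (λ x≡ρy → trans (sym (ρ-involutive y)) (cong ρ (sym x≡ρy)))
                            (y ≟ₐ ρ x) (x ≟ₐ ρ y)

  -- The IsPerm component of a permutation is not propositional without function extensionality,
  -- so sums over permutations are reindexed only for functions that ignore it.
  IsPermIrrelevant : (Perm n → Carrier) → Set ℓ
  IsPermIrrelevant f = ∀ v (v-perm v-perm' : IsPerm v) → f (v , v-perm) ≈ f (v , v-perm')

  extend : (Perm n → Carrier) → Vec (Fin n) n → Carrier
  extend f v with isPerm? v
  ... | yes v-perm = f (v , v-perm)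
  ... | no _       = 0#

  sumS-extend : (f : Perm n → Carrier) → sumS f ≈ ∑ (allVecs n n) (extend f)
  sumS-extend {n} f = go (allVecs n n)
    where
    go : (L : List (Vec (Fin n) n)) → ∑ (mapMaybe toPerm L) f ≈ ∑ L (extend f)
    go []      = ≈-refl
    go (v ∷ L) with isPerm? v
    ... | yes _ = +-congˡ (go L)
    ... | no _  = ≈-trans (go L) (≈-sym (+-identityˡ _))

  sumS-reindex : (ρ : Vec (Fin n) n → Vec (Fin n) n) → (∀ v → ρ (ρ v) ≡ v) →
                 (ρ-isPerm : ∀ {v} → IsPerm v → IsPerm (ρ v)) →
                 {f : Perm n → Carrier} → IsPermIrrelevant f →
                 sumS (λ u → f (ρ (proj₁ u) , ρ-isPerm (proj₂ u))) ≈ sumS f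
  sumS-reindex {n} ρ ρ-involutive ρ-isPerm {f} f-irrelevant = begin
    sumS (f ∘ ρₚ)              ≈⟨ sumS-extend (f ∘ ρₚ) ⟩
    ∑ Vecs (extend (f ∘ ρₚ))   ≈⟨ ∑-cong Vecs extend-commutes ⟩
    ∑ Vecs (extend f ∘ ρ)
      ≈⟨ ∑-involution _≟ᵥ_ (allVecs-unique n n) ∈-allVecs ρ ρ-involutive (extend f) ⟩
    ∑ Vecs (extend f)          ≈⟨ sumS-extend f ⟨
    sumS f                     ∎
    where
    Vecs = allVecs n n
    ρₚ : Perm n → Perm n
    ρₚ u = ρ (proj₁ u) , ρ-isPerm (proj₂ u)
    extend-commutes : ∀ v → extend (f ∘ ρₚ) v ≈ extend f (ρ v)
    extend-commutes v with isPerm? v | isPerm? (ρ v)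
    ... | yes v-perm | yes ρv-perm = f-irrelevant (ρ v) (ρ-isPerm v-perm) ρv-perm
    ... | yes v-perm | no ¬ρv-perm = contradiction (ρ-isPerm v-perm) ¬ρv-perm
    ... | no ¬v-perm | yes ρv-perm = contradiction (subst IsPerm (ρ-involutive v) (ρ-isPerm ρv-perm)) ¬v-perm
    ... | no _       | no _        = ≈-refl

  sumS-∘ᵢ : (σ : Involution n) {f : Perm n → Carrier} → IsPermIrrelevant f →
            sumS (λ u → f (u ∘ᵢ σ)) ≈ sumS f
  sumS-∘ᵢ σ = sumS-reindex (precomposeVec σ) (precomposeVec-involutive σ) (λ {v} → precomposeVec-isPerm σ {v})

  sumS-ᵢ∘ : (σ : Involution n) {f : Perm n → Carrier} → IsPermIrrelevant f →
            sumS (λ u → f (σ ᵢ∘ u)) ≈ sumS f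
  sumS-ᵢ∘ σ = sumS-reindex (postcomposeVec σ) (postcomposeVec-involutive σ) (λ {v} → postcomposeVec-isPerm σ {v})

  sumS²-cong : {f g : Perm n → Perm n → Carrier} → (∀ a b → f a b ≈ g a b) →
               sumS (λ a → sumS (f a)) ≈ sumS (λ a → sumS (g a))
  sumS²-cong {n} f≈g = ∑-cong (allPerms n) (λ a → ∑-cong (allPerms n) (f≈g a))

  []*-sumS² : ∀ b (f : Perm n → Perm n → Carrier) →
              [ b ]* sumS (λ a → sumS (f a)) ≈ sumS (λ a → sumS (λ a' → [ b ]* f a a'))
  []*-sumS² {n} b f =
    ≈-sym (≈-trans (∑-cong (allPerms n) (λ a → ∑-[]* (allPerms n) b (f a))) (∑-[]* (allPerms n) b _))

  infix 4 _==ₚ_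
  _==ₚ_ : Perm n → Perm n → Bool
  u ==ₚ w = ⌊ proj₁ u ≟ᵥ proj₁ w ⌋

  sumS-δ : (u₀ : Perm n) {H : Perm n → Carrier} → IsPermIrrelevant H →
           sumS (λ u → [ u₀ ==ₚ u ]* H u) ≈ H u₀
  sumS-δ {n} u₀@(v₀ , v₀-perm) {H} H-irrelevant = begin
    sumS (λ u → [ u₀ ==ₚ u ]* H u)              ≈⟨ sumS-extend (λ u → [ u₀ ==ₚ u ]* H u) ⟩
    ∑ Vecs (extend (λ u → [ u₀ ==ₚ u ]* H u))   ≈⟨ ∑-cong Vecs extend-δ ⟩
    ∑ Vecs (λ v → [ ⌊ v ≟ᵥ v₀ ⌋ ]* extend H v) ≈⟨ ∑-δ _≟ᵥ_ (allVecs-unique n n) (∈-allVecs v₀) (extend H) ⟩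
    extend H v₀                                ≈⟨ extend-perm ⟩
    H u₀                                       ∎
    where
    Vecs = allVecs n n
    extend-δ : ∀ v → extend (λ u → [ u₀ ==ₚ u ]* H u) v ≈ [ ⌊ v ≟ᵥ v₀ ⌋ ]* extend H v
    extend-δ v with isPerm? v
    ... | yes _ = reflexive (cong ([_]* _) (⌊⌋-⇔ sym sym (v₀ ≟ᵥ v) (v ≟ᵥ v₀)))
    ... | no _  = ≈-sym ([]*-zero ⌊ v ≟ᵥ v₀ ⌋)
    extend-perm : extend H v₀ ≈ H (v₀ , v₀-perm)
    extend-perm with isPerm? v₀
    ... | yes v₀-perm' = H-irrelevant v₀ v₀-perm' v₀-perm
    ... | no ¬v₀-perm = contradiction v₀-perm ¬v₀-perm

  -- Splitting along the predicate u p < u q pairs u with u ∘ (p q), so no division by 2 is needed.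
  sumS-odd : (p q : Fin n) → p ≢ q → {G : Perm n → Carrier} → IsPermIrrelevant G →
             (∀ u → G (u ∘ᵢ transposition p q) ≈ - G u) → sumS G ≈ 0#
  sumS-odd {n} p q p≢q {G} G-irrelevant G-odd = begin
    sumS G                                                   ≈⟨ ∑-cong Perms (λ u → []*-split (P u) (G u)) ⟩
    sumS (λ u → [ P u ]* G u + [ not (P u) ]* G u)           ≈⟨ ∑-+ Perms _ _ ⟩
    S₊ + sumS (λ u → [ not (P u) ]* G u)                     ≈⟨ +-congˡ (sumS-∘ᵢ t negative-irrelevant) ⟨
    S₊ + sumS (λ u → [ not (P (u ∘ᵢ t)) ]* G (u ∘ᵢ t))       ≈⟨ +-congˡ (∑-cong Perms swapped) ⟩
    S₊ + sumS (λ u → - [ P u ]* G u)                         ≈⟨ +-congˡ (∑-neg Perms _) ⟩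
    S₊ - S₊                                                  ≈⟨ -‿inverseʳ S₊ ⟩
    0#                                                       ∎
    where
    Perms = allPerms n
    t = transposition p q
    P : Perm n → Bool
    P u = ⌊ app u p <? app u q ⌋
    S₊ = sumS (λ u → [ P u ]* G u)
    negative-irrelevant : IsPermIrrelevant (λ u → [ not (P u) ]* G u)
    negative-irrelevant v v-perm v-perm' = []*-cong (not (P (v , v-perm))) (G-irrelevant v v-perm v-perm')
    P-flips : ∀ u → P (u ∘ᵢ t) ≡ not (P u)
    P-flips u rewrite app-∘ᵢ u t p | app-∘ᵢ u t q | transpose-matchˡ p q | transpose-matchʳ p q =
      ⌊⌋-complement (λ uq<up up<uq → Finₚ.<-asym up<uq uq<up) ¬up<uq⇒uq<up
                    (app u q <? app u p) (app u p <? app u q)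
      where
      ¬up<uq⇒uq<up : ¬ (app u p < app u q) → app u q < app u p
      ¬up<uq⇒uq<up ¬up<uq with Finₚ.<-cmp (app u p) (app u q)
      ... | tri< up<uq _ _ = contradiction up<uq ¬up<uq
      ... | tri≈ _ up≡uq _ = contradiction (app-injective u up≡uq) p≢q
      ... | tri> _ _ uq<up = uq<up
    swapped : ∀ u → [ not (P (u ∘ᵢ t)) ]* G (u ∘ᵢ t) ≈ - [ P u ]* G u
    swapped u rewrite P-flips u | not-involutive (P u) = ≈-trans ([]*-cong (P u) (G-odd u)) ([]*-neg (P u) (G u))

  -- Products

  product₃ : El n → El n → El n → El n
  product₃ {n} x y z w = sumS λ a → sumS λ b → sumS λ d → [ a ∘ₚ b ∘ₚ d ==ₚ w ]* (x a * y b * z d)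

  [x·y]·z≈product₃ : (x y z : El n) (w : Perm n) → ((x · y) · z) w ≈ product₃ x y z w
  [x·y]·z≈product₃ {n} x y z w = begin
    sumS (λ u → sumS (λ d → [ u ∘ₚ d ==ₚ w ]* ((x · y) u * z d)))
      ≈⟨ sumS²-cong {n} distribute ⟩
    sumS (λ u → sumS (λ d → sumS (λ a → sumS (λ b → F a b d u))))
      ≈⟨ ∑-comm Perms Perms _ ⟩
    sumS (λ d → sumS (λ u → sumS (λ a → sumS (λ b → F a b d u))))
      ≈⟨ ∑-cong Perms (λ d → ∑-comm Perms Perms _) ⟩
    sumS (λ d → sumS (λ a → sumS (λ u → sumS (λ b → F a b d u))))
      ≈⟨ sumS²-cong {n} (λ d a → ∑-comm Perms Perms _) ⟩
    sumS (λ d → sumS (λ a → sumS (λ b → sumS (λ u → F a b d u))))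
      ≈⟨ sumS²-cong {n} (λ d a → ∑-cong Perms (λ b → sumS-δ (a ∘ₚ b) (λ _ _ _ → ≈-refl))) ⟩
    sumS (λ d → sumS (λ a → sumS (λ b → [ a ∘ₚ b ∘ₚ d ==ₚ w ]* (x a * y b * z d))))
      ≈⟨ ∑-comm Perms Perms _ ⟩
    sumS (λ a → sumS (λ d → sumS (λ b → [ a ∘ₚ b ∘ₚ d ==ₚ w ]* (x a * y b * z d))))
      ≈⟨ ∑-cong Perms (λ a → ∑-comm Perms Perms _) ⟩
    product₃ x y z w ∎
    where
    Perms = allPerms n
    F : Perm n → Perm n → Perm n → Perm n → Carrier
    F a b d u = [ a ∘ₚ b ==ₚ u ]* [ u ∘ₚ d ==ₚ w ]* (x a * y b * z d)
    distribute : ∀ u d → [ u ∘ₚ d ==ₚ w ]* ((x · y) u * z d) ≈ sumS (λ a → sumS (λ b → F a b d u))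
    distribute u d = begin
      [ u ∘ₚ d ==ₚ w ]* ((x · y) u * z d)
        ≈⟨ []*-cong (u ∘ₚ d ==ₚ w)
             (≈-trans (∑-*ʳ Perms (z d) _) (∑-cong Perms (λ a → ∑-*ʳ Perms (z d) _))) ⟩
      [ u ∘ₚ d ==ₚ w ]* sumS (λ a → sumS (λ b → [ a ∘ₚ b ==ₚ u ]* (x a * y b) * z d))
        ≈⟨ []*-sumS² {n} (u ∘ₚ d ==ₚ w) _ ⟩
      sumS (λ a → sumS (λ b → [ u ∘ₚ d ==ₚ w ]* ([ a ∘ₚ b ==ₚ u ]* (x a * y b) * z d)))
        ≈⟨ sumS²-cong {n} (λ a b → []*-cong (u ∘ₚ d ==ₚ w) ([]*-*ʳ (a ∘ₚ b ==ₚ u) _ _)) ⟩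
      sumS (λ a → sumS (λ b → [ u ∘ₚ d ==ₚ w ]* [ a ∘ₚ b ==ₚ u ]* (x a * y b * z d)))
        ≈⟨ sumS²-cong {n} (λ a b → reflexive ([]*-comm (u ∘ₚ d ==ₚ w) (a ∘ₚ b ==ₚ u) _)) ⟩
      sumS (λ a → sumS (λ b → F a b d u)) ∎

  x·[y·z]≈product₃ : (x y z : El n) (w : Perm n) → (x · (y · z)) w ≈ product₃ x y z w
  x·[y·z]≈product₃ {n} x y z w = begin
    sumS (λ a → sumS (λ t → [ a ∘ₚ t ==ₚ w ]* (x a * (y · z) t)))
      ≈⟨ sumS²-cong {n} distribute ⟩
    sumS (λ a → sumS (λ t → sumS (λ b → sumS (λ d → F a b d t))))
      ≈⟨ ∑-cong Perms (λ a → ∑-comm Perms Perms _) ⟩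
    sumS (λ a → sumS (λ b → sumS (λ t → sumS (λ d → F a b d t))))
      ≈⟨ sumS²-cong {n} (λ a b → ∑-comm Perms Perms _) ⟩
    sumS (λ a → sumS (λ b → sumS (λ d → sumS (λ t → F a b d t))))
      ≈⟨ sumS²-cong {n} (λ a b → ∑-cong Perms (λ d → sumS-δ (b ∘ₚ d) (λ _ _ _ → ≈-refl))) ⟩
    sumS (λ a → sumS (λ b → sumS (λ d → [ a ∘ₚ (b ∘ₚ d) ==ₚ w ]* (x a * y b * z d))))
      ≈⟨ sumS²-cong {n} (λ a b → ∑-cong Perms (λ d →
           reflexive (cong (λ v → [ ⌊ v ≟ᵥ proj₁ w ⌋ ]* _) (∘ₚ-assoc a b d)))) ⟩
    product₃ x y z w ∎
    where
    Perms = allPerms n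
    F : Perm n → Perm n → Perm n → Perm n → Carrier
    F a b d t = [ b ∘ₚ d ==ₚ t ]* [ a ∘ₚ t ==ₚ w ]* (x a * y b * z d)
    distribute : ∀ a t → [ a ∘ₚ t ==ₚ w ]* (x a * (y · z) t) ≈ sumS (λ b → sumS (λ d → F a b d t))
    distribute a t = begin
      [ a ∘ₚ t ==ₚ w ]* (x a * (y · z) t)
        ≈⟨ []*-cong (a ∘ₚ t ==ₚ w)
             (≈-trans (∑-*ˡ Perms (x a) _) (∑-cong Perms (λ b → ∑-*ˡ Perms (x a) _))) ⟩
      [ a ∘ₚ t ==ₚ w ]* sumS (λ b → sumS (λ d → x a * [ b ∘ₚ d ==ₚ t ]* (y b * z d)))
        ≈⟨ []*-sumS² {n} (a ∘ₚ t ==ₚ w) _ ⟩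
      sumS (λ b → sumS (λ d → [ a ∘ₚ t ==ₚ w ]* (x a * [ b ∘ₚ d ==ₚ t ]* (y b * z d))))
        ≈⟨ sumS²-cong {n} (λ b d → []*-cong (a ∘ₚ t ==ₚ w)
             (≈-trans ([]*-*ˡ (b ∘ₚ d ==ₚ t) _ _) ([]*-cong (b ∘ₚ d ==ₚ t) (≈-sym (*-assoc _ _ _))))) ⟩
      sumS (λ b → sumS (λ d → [ a ∘ₚ t ==ₚ w ]* [ b ∘ₚ d ==ₚ t ]* (x a * y b * z d)))
        ≈⟨ sumS²-cong {n} (λ b d → reflexive ([]*-comm (a ∘ₚ t ==ₚ w) (b ∘ₚ d ==ₚ t) _)) ⟩
      sumS (λ b → sumS (λ d → F a b d t)) ∎

  ·-assoc : (x y z : El n) → ((x · y) · z) ≋ (x · (y · z))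
  ·-assoc x y z w = ≈-trans ([x·y]·z≈product₃ x y z w) (≈-sym (x·[y·z]≈product₃ x y z w))

  ·-cong : {x x' y y' : El n} → x ≋ x' → y ≋ y' → (x · y) ≋ (x' · y')
  ·-cong {n} x≋x' y≋y' w = sumS²-cong {n} (λ u v → []*-cong (u ∘ₚ v ==ₚ w) (*-cong (x≋x' u) (y≋y' v)))

  ·-zeroˡ : (y : El n) → (zeroA · y) ≋ zeroA
  ·-zeroˡ {n} y w = ∑-zero-pointwise (allPerms n) λ u → ∑-zero-pointwise (allPerms n) λ v →
    ≈-trans ([]*-cong (u ∘ₚ v ==ₚ w) (zeroˡ (y v))) ([]*-zero (u ∘ₚ v ==ₚ w))

  ·-zeroʳ : (x : El n) → (x · zeroA) ≋ zeroA
  ·-zeroʳ {n} x w = ∑-zero-pointwise (allPerms n) λ u → ∑-zero-pointwise (allPerms n) λ v →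
    ≈-trans ([]*-cong (u ∘ₚ v ==ₚ w) (zeroʳ (x u))) ([]*-zero (u ∘ₚ v ==ₚ w))

  ·-sumElˡ : (xs : List (El n)) (y : El n) (w : Perm n) → (sumEl xs · y) w ≈ ∑ xs (λ x → (x · y) w)
  ·-sumElˡ {n} xs y w = begin
    (sumEl xs · y) w
      ≈⟨ sumS²-cong {n} (λ u v →
           ≈-trans ([]*-cong (u ∘ₚ v ==ₚ w) (∑-*ʳ xs (y v) _)) (≈-sym (∑-[]* xs (u ∘ₚ v ==ₚ w) _))) ⟩
    sumS (λ u → sumS (λ v → ∑ xs (λ x → [ u ∘ₚ v ==ₚ w ]* (x u * y v))))
      ≈⟨ ∑-cong (allPerms n) (λ u → ∑-comm (allPerms n) xs _) ⟩
    sumS (λ u → ∑ xs (λ x → sumS (λ v → [ u ∘ₚ v ==ₚ w ]* (x u * y v))))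
      ≈⟨ ∑-comm (allPerms n) xs _ ⟩
    ∑ xs (λ x → (x · y) w) ∎

  ·-sumElʳ : (x : El n) (ys : List (El n)) (w : Perm n) → (x · sumEl ys) w ≈ ∑ ys (λ y → (x · y) w)
  ·-sumElʳ {n} x ys w = begin
    (x · sumEl ys) w
      ≈⟨ sumS²-cong {n} (λ u v →
           ≈-trans ([]*-cong (u ∘ₚ v ==ₚ w) (∑-*ˡ ys (x u) _)) (≈-sym (∑-[]* ys (u ∘ₚ v ==ₚ w) _))) ⟩
    sumS (λ u → sumS (λ v → ∑ ys (λ y → [ u ∘ₚ v ==ₚ w ]* (x u * y v))))
      ≈⟨ ∑-cong (allPerms n) (λ u → ∑-comm (allPerms n) ys _) ⟩
    sumS (λ u → ∑ ys (λ y → sumS (λ v → [ u ∘ₚ v ==ₚ w ]* (x u * y v))))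
      ≈⟨ ∑-comm (allPerms n) ys _ ⟩
    ∑ ys (λ y → (x · y) w) ∎

  span-·-span : {I : Set a} {J : Set b} (f : I → El n) (g : J → El n) → (∀ i j → (f i · g j) ≋ zeroA) →
                {x y : El n} → ∃[ is ] (x ≋ sumEl (map f is)) → ∃[ js ] (y ≋ sumEl (map g js)) →
                (x · y) ≋ zeroA
  span-·-span f g generators-vanish {x} {y} (is , x≋) (js , y≋) w = begin
    (x · y) w                                        ≈⟨ ·-cong x≋ y≋ w ⟩
    (sumEl (map f is) · sumEl (map g js)) w          ≈⟨ ·-sumElˡ (map f is) _ w ⟩
    ∑ (map f is) (λ x' → (x' · sumEl (map g js)) w)  ≡⟨ ∑-map f is _ ⟩
    ∑ is (λ i → (f i · sumEl (map g js)) w)          ≈⟨ ∑-cong is (λ i → ·-sumElʳ (f i) (map g js) w) ⟩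
    ∑ is (λ i → ∑ (map g js) (λ y' → (f i · y') w))  ≈⟨ ∑-cong is (λ i → reflexive (∑-map g js _)) ⟩
    ∑ is (λ i → ∑ js (λ j → (f i · g j) w))
      ≈⟨ ∑-zero-pointwise is (λ i → ∑-zero-pointwise js (λ j → generators-vanish i j w)) ⟩
    0#                                               ∎

  -- Signs

  sign-pointwise : (g h : Perm n) → (∀ i → app g i ≡ app h i) → sign g ≡ sign h
  sign-pointwise g h g≗h = same-vector g h (lookup-ext g≗h)
    where
    same-vector : (g h : Perm n) → proj₁ g ≡ proj₁ h → sign g ≡ sign h
    same-vector (v , _) (.v , _) refl = refl

  sign-adjacent : (k k' : Fin n) → toℕ k' ≡ ℕ.suc (toℕ k) → (g : Perm n) →
                  sign (transposition k k' ᵢ∘ g) ≈ - sign g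
  sign-adjacent k k' adjacent g with inversions-adjacent k k' adjacent g
  ... | inj₁ more-in-g = ≈-trans (≈-sym (-‿involutive _)) (-‿cong (reflexive (cong negOnePow (sym more-in-g))))
  ... | inj₂ more-in-h = reflexive (cong negOnePow more-in-h)

  sign-transpose-at-distance : ∀ d (a b : Fin n) → toℕ b ≡ ℕ.suc (d ℕ.+ toℕ a) →
                               (g : Perm n) → sign (transposition a b ᵢ∘ g) ≈ - sign g
  sign-transpose-at-distance ℕ.zero    a b adjacent g = sign-adjacent a b adjacent g
  sign-transpose-at-distance {n} (ℕ.suc d) a b b≡ g = begin
    sign (transposition a b ᵢ∘ g)           ≡⟨ sign-pointwise (transposition a b ᵢ∘ g) (t-b⁻b ᵢ∘ t-ab⁻ ᵢ∘ t-b⁻b ᵢ∘ g)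
                                                 (ᵢ∘-transposition-via a b b⁻ (a≢ b⁻≡) (a≢ b≡) g) ⟩
    sign (t-b⁻b ᵢ∘ t-ab⁻ ᵢ∘ t-b⁻b ᵢ∘ g)     ≈⟨ sign-adjacent b⁻ b b≡1+b⁻ (t-ab⁻ ᵢ∘ t-b⁻b ᵢ∘ g) ⟩
    - sign (t-ab⁻ ᵢ∘ t-b⁻b ᵢ∘ g)            ≈⟨ -‿cong (sign-transpose-at-distance d a b⁻ b⁻≡ (t-b⁻b ᵢ∘ g)) ⟩
    - - sign (t-b⁻b ᵢ∘ g)                   ≈⟨ -‿involutive _ ⟩
    sign (t-b⁻b ᵢ∘ g)                       ≈⟨ sign-adjacent b⁻ b b≡1+b⁻ g ⟩
    - sign g                                ∎
    where
    b⁻<n : ℕ.suc (d ℕ.+ toℕ a) ℕ.< n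
    b⁻<n = ℕₚ.<-trans (subst (ℕ.suc (d ℕ.+ toℕ a) ℕ.<_) (sym b≡) (ℕₚ.n<1+n _)) (Finₚ.toℕ<n b)
    b⁻ : Fin n
    b⁻ = Fin.fromℕ< b⁻<n
    b⁻≡ : toℕ b⁻ ≡ ℕ.suc (d ℕ.+ toℕ a)
    b⁻≡ = Finₚ.toℕ-fromℕ< b⁻<n
    b≡1+b⁻ : toℕ b ≡ ℕ.suc (toℕ b⁻)
    b≡1+b⁻ = trans b≡ (cong ℕ.suc (sym b⁻≡))
    a≢ : ∀ {e x} → toℕ x ≡ ℕ.suc (e ℕ.+ toℕ a) → a ≢ x
    a≢ x≡ a≡x = ℕₚ.m≢1+n+m (toℕ a) (trans (cong toℕ a≡x) x≡)
    t-b⁻b = transposition b⁻ b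
    t-ab⁻ = transposition a b⁻

  sign-transpose : (a b : Fin n) → a ≢ b → (g : Perm n) → sign (transposition a b ᵢ∘ g) ≈ - sign g
  sign-transpose a b a≢b g with Finₚ.<-cmp a b
  ... | tri< a<b _ _ = let d , b≡ = <⇒distance a<b in sign-transpose-at-distance d a b b≡ g
  ... | tri≈ _ a≡b _ = contradiction a≡b a≢b
  ... | tri> _ _ b<a = let d , a≡ = <⇒distance b<a in begin
    sign (transposition a b ᵢ∘ g) ≡⟨ sign-pointwise (transposition a b ᵢ∘ g) (transposition b a ᵢ∘ g) comm ⟩
    sign (transposition b a ᵢ∘ g) ≈⟨ sign-transpose-at-distance d b a a≡ g ⟩
    - sign g                      ∎
    where
    comm : ∀ i → app (transposition a b ᵢ∘ g) i ≡ app (transposition b a ᵢ∘ g) i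
    comm i = trans (app-ᵢ∘ (transposition a b) g i)
                   (trans (transpose-comm a b (app g i)) (sym (app-ᵢ∘ (transposition b a) g i)))

  ∇⁻-transposition-ᵢ∘ : (U : Subset n) {p q : Fin n} → p ≢ q → p ∈ U → q ∈ U →
                        ∀ v → ∇⁻ U (transposition p q ᵢ∘ v) ≈ - ∇⁻ U v
  ∇⁻-transposition-ᵢ∘ U {p} {q} p≢q p∈U q∈U v = begin
    [ ⌊ fixesOutside? U (t ᵢ∘ v) ⌋ ]* sign (t ᵢ∘ v) ≡⟨ cong ([_]* sign (t ᵢ∘ v)) same-support ⟩
    [ ⌊ fixesOutside? U v ⌋ ]* sign (t ᵢ∘ v)       ≈⟨ []*-cong ⌊ fixesOutside? U v ⌋ (sign-transpose p q p≢q v) ⟩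
    [ ⌊ fixesOutside? U v ⌋ ]* (- sign v)          ≈⟨ []*-neg ⌊ fixesOutside? U v ⌋ (sign v) ⟩
    - ∇⁻ U v                                        ∎
    where
    t = transposition p q
    same-support : ⌊ fixesOutside? U (t ᵢ∘ v) ⌋ ≡ ⌊ fixesOutside? U v ⌋
    same-support = let open Equivalence (fixesOutside-ᵢ∘ {σ = t} (transposition-fixesOutside {U = U} p∈U q∈U) v) in
      ⌊⌋-⇔ to from (fixesOutside? U (t ᵢ∘ v)) (fixesOutside? U v)

  ∇⁻-∘ᵢ-transposition : (U : Subset n) {p q : Fin n} → p ≢ q → p ∈ U → q ∈ U →
                        ∀ u → ∇⁻ U (u ∘ᵢ transposition p q) ≈ - ∇⁻ U u
  ∇⁻-∘ᵢ-transposition U {p} {q} p≢q p∈U q∈U u = begin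
    [ ⌊ fixesOutside? U (u ∘ᵢ t) ⌋ ]* sign (u ∘ᵢ t) ≡⟨ cong ([_]* sign (u ∘ᵢ t)) same-support ⟩
    [ ⌊ fixesOutside? U u ⌋ ]* sign (u ∘ᵢ t)
      ≡⟨ cong ([ ⌊ fixesOutside? U u ⌋ ]*_) (sign-pointwise (u ∘ᵢ t) (t' ᵢ∘ u) (∘ᵢ-transposition u p q)) ⟩
    [ ⌊ fixesOutside? U u ⌋ ]* sign (t' ᵢ∘ u)
      ≈⟨ []*-cong ⌊ fixesOutside? U u ⌋ (sign-transpose (app u p) (app u q) (p≢q ∘ app-injective u) u) ⟩
    [ ⌊ fixesOutside? U u ⌋ ]* (- sign u)          ≈⟨ []*-neg ⌊ fixesOutside? U u ⌋ (sign u) ⟩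
    - ∇⁻ U u                                        ∎
    where
    t = transposition p q
    t' = transposition (app u p) (app u q)
    same-support : ⌊ fixesOutside? U (u ∘ᵢ t) ⌋ ≡ ⌊ fixesOutside? U u ⌋
    same-support = let open Equivalence (fixesOutside-∘ᵢ {σ = t} (transposition-fixesOutside {U = U} p∈U q∈U) u) in
      ⌊⌋-⇔ to from (fixesOutside? U (u ∘ᵢ t)) (fixesOutside? U u)

  ∇-∘ᵢ : (𝐁 𝐀 : SetComp n m) {σ : Involution n} → PreservesBlocks σ 𝐀 →
         ∀ u → ∇ 𝐁 𝐀 (u ∘ᵢ σ) ≡ ∇ 𝐁 𝐀 u
  ∇-∘ᵢ 𝐁 𝐀 {σ} σ-preserves u = cong ([_]* 1#)
    (⌊⌋-⇔ to from (mapsComp? (u ∘ᵢ σ) 𝐀 𝐁) (mapsComp? u 𝐀 𝐁))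
    where open Equivalence (mapsComp-∘ᵢ-⇔ {𝐀 = 𝐀} {𝐁} {σ} σ-preserves u)

  ∇-ᵢ∘ : (𝐁 𝐀 : SetComp n m) {σ : Involution n} → PreservesBlocks σ 𝐁 →
         ∀ u → ∇ 𝐁 𝐀 (σ ᵢ∘ u) ≡ ∇ 𝐁 𝐀 u
  ∇-ᵢ∘ 𝐁 𝐀 {σ} σ-preserves u = cong ([_]* 1#)
    (⌊⌋-⇔ to from (mapsComp? (σ ᵢ∘ u) 𝐀 𝐁) (mapsComp? u 𝐀 𝐁))
    where open Equivalence (mapsComp-ᵢ∘-⇔ {𝐀 = 𝐀} {𝐁} {σ} σ-preserves u)

  product₃-slice : El n → El n → El n → Perm n → Perm n → Carrier
  product₃-slice x y z w b = sumS λ a → sumS λ d → [ a ∘ₚ b ∘ₚ d ==ₚ w ]* (x a * y b * z d)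

  product₃-vanishes : (x y z : El n) (w : Perm n) → (∀ b → product₃-slice x y z w b ≈ 0#) →
                      product₃ x y z w ≈ 0#
  product₃-vanishes {n} x y z w slices-vanish =
    ≈-trans (∑-comm (allPerms n) (allPerms n) _) (∑-zero-pointwise (allPerms n) slices-vanish)

  -- Substituting a ↦ a (p q) and d ↦ t d fixes the product a b d but flips the sign of each term.
  product₃-slice-vanishes : (p q : Fin n) → p ≢ q → (t : Involution n) (b : Perm n) →
    (∀ i → transpose p q (app b i) ≡ app b (t ⟨$⟩ i)) →
    {x z : El n} → IsPermIrrelevant x → IsPermIrrelevant z →
    (∀ a d → x (a ∘ᵢ transposition p q) * z (t ᵢ∘ d) ≈ - (x a * z d)) →
    (y : El n) (w : Perm n) → product₃-slice x y z w b ≈ 0#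
  product₃-slice-vanishes {n} p q p≢q t b conjugate {x} {z} x-irrelevant z-irrelevant odd y w =
    sumS-odd p q p≢q G-irrelevant G-odd
    where
    Perms = allPerms n
    s = transposition p q
    F : Perm n → Perm n → Carrier
    F a d = [ a ∘ₚ b ∘ₚ d ==ₚ w ]* (x a * y b * z d)
    G : Perm n → Carrier
    G a = sumS (F a)
    G-irrelevant : IsPermIrrelevant G
    G-irrelevant v v-perm v-perm' = ∑-cong Perms λ d →
      []*-cong ((v , v-perm) ∘ₚ b ∘ₚ d ==ₚ w) (*-congʳ (*-congʳ (x-irrelevant v v-perm v-perm')))
    F-irrelevant : ∀ a → IsPermIrrelevant (F a)
    F-irrelevant a v v-perm v-perm' =
      []*-cong (a ∘ₚ b ∘ₚ (v , v-perm) ==ₚ w) (*-congˡ (z-irrelevant v v-perm v-perm'))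
    G-odd : ∀ a → G (a ∘ᵢ s) ≈ - G a
    G-odd a = begin
      sumS (F (a ∘ᵢ s))                    ≈⟨ sumS-ᵢ∘ t (F-irrelevant (a ∘ᵢ s)) ⟨
      sumS (λ d → F (a ∘ᵢ s) (t ᵢ∘ d))     ≈⟨ ∑-cong Perms term-odd ⟩
      sumS (λ d → - F a d)                 ≈⟨ ∑-neg Perms (F a) ⟩
      - G a                                ∎
      where
      term-odd : ∀ d → F (a ∘ᵢ s) (t ᵢ∘ d) ≈ - F a d
      term-odd d = begin
        [ a ∘ᵢ s ∘ₚ b ∘ₚ (t ᵢ∘ d) ==ₚ w ]* (x (a ∘ᵢ s) * y b * z (t ᵢ∘ d))
          ≡⟨ cong (λ v → [ ⌊ v ≟ᵥ proj₁ w ⌋ ]* (x (a ∘ᵢ s) * y b * z (t ᵢ∘ d)))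
                  (∘ₚ-intertwined s t b conjugate a d) ⟩
        [ a ∘ₚ b ∘ₚ d ==ₚ w ]* (x (a ∘ᵢ s) * y b * z (t ᵢ∘ d))
          ≈⟨ []*-cong (a ∘ₚ b ∘ₚ d ==ₚ w) (≈-trans (xy∙z≈y∙xz _ _ _) (*-congˡ (odd a d))) ⟩
        [ a ∘ₚ b ∘ₚ d ==ₚ w ]* (y b * - (x a * z d))
          ≈⟨ []*-cong (a ∘ₚ b ∘ₚ d ==ₚ w)
               (≈-trans (≈-sym (-‿distribʳ-* _ _)) (-‿cong (≈-sym (xy∙z≈y∙xz _ _ _)))) ⟩
        [ a ∘ₚ b ∘ₚ d ==ₚ w ]* (- (x a * y b * z d))
          ≈⟨ []*-neg (a ∘ₚ b ∘ₚ d ==ₚ w) _ ⟩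
        - F a d ∎

  module _ {k : ℕ} (g : IGen n k) (h : JGen n k) where
    private
      open IGen g using (len; len≤; coef; 𝐀; 𝐁)
      open JGen h using (U; |U|; left; right)
      X = IGen-el g
      N = ∇⁻ U

      len<∣U∣ : len ℕ.< ∣ U ∣
      len<∣U∣ = subst (len ℕ.<_) (sym |U|) (ℕ.s≤s len≤)

      X-irrelevant : IsPermIrrelevant X
      X-irrelevant _ _ _ = ≈-refl

      N-irrelevant : IsPermIrrelevant N
      N-irrelevant _ _ _ = ≈-refl

      blockOf : (𝐂 : SetComp n len) → Fin n → Fin len
      blockOf 𝐂 x = proj₁ (covers 𝐂 x)

      ∈-blockOf : (𝐂 : SetComp n len) (x : Fin n) → x ∈ block 𝐂 (blockOf 𝐂 x)
      ∈-blockOf 𝐂 x = proj₂ (covers 𝐂 x)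

    X·left·N-vanishes : ((X · left) · N) ≋ zeroA
    X·left·N-vanishes w =
      ≈-trans ([x·y]·z≈product₃ X left N w) (product₃-vanishes X left N w slice-vanishes)
      where
      slice-vanishes : ∀ y → product₃-slice X left N w y ≈ 0#
      slice-vanishes y = product₃-slice-vanishes (app y p) (app y q) (p≢q ∘ app-injective y)
        (transposition p q) y (transpose-conjugate (app y) (app-injective y) p q)
        X-irrelevant N-irrelevant odd left w
        where
        open Collision (subset-pigeonhole U len<∣U∣ (blockOf 𝐀 ∘ app y))
        s-preserves : PreservesBlocks (transposition (app y p) (app y q)) 𝐀
        s-preserves = transposition-preservesBlocks 𝐀 (∈-blockOf 𝐀 (app y p))
          (subst (λ j → app y q ∈ block 𝐀 j) (sym collides) (∈-blockOf 𝐀 (app y q)))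
        odd : ∀ a d → X (a ∘ᵢ transposition (app y p) (app y q)) * N (transposition p q ᵢ∘ d) ≈
                      - (X a * N d)
        odd a d = begin
          coef * ∇ 𝐁 𝐀 (a ∘ᵢ transposition (app y p) (app y q)) * N (transposition p q ᵢ∘ d)
            ≈⟨ *-cong (*-congˡ (reflexive (∇-∘ᵢ 𝐁 𝐀 {transposition (app y p) (app y q)} s-preserves a)))
                      (∇⁻-transposition-ᵢ∘ U p≢q p∈U q∈U d) ⟩
          X a * - N d ≈⟨ -‿distribʳ-* (X a) (N d) ⟨
          - (X a * N d) ∎

    -- Mirror image of the above: z⁻¹ maps two points p ≠ q of U into one block of B, and
    -- (p q) z = z (z⁻¹p  z⁻¹q).
    N·right·X-vanishes : (N · (right · X)) ≋ zeroA
    N·right·X-vanishes w =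
      ≈-trans (x·[y·z]≈product₃ N right X w) (product₃-vanishes N right X w slice-vanishes)
      where
      slice-vanishes : ∀ z → product₃-slice N right X w z ≈ 0#
      slice-vanishes z = product₃-slice-vanishes p q p≢q (transposition p' q') z conjugate
        N-irrelevant X-irrelevant odd right w
        where
        open Collision (subset-pigeonhole U len<∣U∣ (blockOf 𝐁 ∘ preimage z))
        p' = preimage z p
        q' = preimage z q
        conjugate : ∀ i → transpose p q (app z i) ≡ app z (transpose p' q' i)
        conjugate i = subst₂ (λ p″ q″ → transpose p″ q″ (app z i) ≡ app z (transpose p' q' i))
          (app-preimage z p) (app-preimage z q) (transpose-conjugate (app z) (app-injective z) p' q' i)
        t-preserves : PreservesBlocks (transposition p' q') 𝐁
        t-preserves = transposition-preservesBlocks 𝐁 (∈-blockOf 𝐁 p')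
          (subst (λ j → q' ∈ block 𝐁 j) (sym collides) (∈-blockOf 𝐁 q'))
        odd : ∀ a d → N (a ∘ᵢ transposition p q) * X (transposition p' q' ᵢ∘ d) ≈ - (N a * X d)
        odd a d = begin
          N (a ∘ᵢ transposition p q) * (coef * ∇ 𝐁 𝐀 (transposition p' q' ᵢ∘ d))
            ≈⟨ *-cong (∇⁻-∘ᵢ-transposition U p≢q p∈U q∈U a)
                      (*-congˡ (reflexive (∇-ᵢ∘ 𝐁 𝐀 {transposition p' q'} t-preserves d))) ⟩
          - N a * X d ≈⟨ -‿distribˡ-* (N a) (X d) ⟨
          - (N a * X d) ∎

    IGen·JGen-vanishes : (X · JGen-el h) ≋ zeroA
    IGen·JGen-vanishes w = begin
      (X · ((left · N) · right)) w   ≈⟨ ·-assoc X (left · N) right w ⟨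
      ((X · (left · N)) · right) w   ≈⟨ ·-cong (λ u → ·-assoc X left N u) (λ _ → ≈-refl) w ⟨
      (((X · left) · N) · right) w   ≈⟨ ·-cong X·left·N-vanishes (λ _ → ≈-refl) w ⟩
      (zeroA · right) w              ≈⟨ ·-zeroˡ right w ⟩
      0#                             ∎

    JGen·IGen-vanishes : (JGen-el h · X) ≋ zeroA
    JGen·IGen-vanishes w = begin
      (((left · N) · right) · X) w   ≈⟨ ·-assoc (left · N) right X w ⟩
      ((left · N) · (right · X)) w   ≈⟨ ·-assoc left N (right · X) w ⟩
      (left · (N · (right · X))) w   ≈⟨ ·-cong (λ _ → ≈-refl) N·right·X-vanishes w ⟩
      (left · zeroA) w               ≈⟨ ·-zeroʳ left w ⟩
      0#                             ∎

lemma2p5p4 : ∀ {c ℓ} (R : CommutativeRing c ℓ) (n k : ℕ) →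
    let open GroupAlgebra R in
    ∀ (x y : El n) → Inℐ n k x → In𝒥 n k y →
      ((x · y) ≋ zeroA) × ((y · x) ≋ zeroA)
lemma2p5p4 R n k x y x∈ℐ y∈𝒥 =
    span-·-span IGen-el JGen-el IGen·JGen-vanishes x∈ℐ y∈𝒥
  , span-·-span JGen-el IGen-el (λ h g → JGen·IGen-vanishes g h) y∈𝒥 x∈ℐ
  where
  open GroupAlgebra R
  open GroupAlgebraLemmas R
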